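{- Let $\sigma=e_1,\ldots,e_m$ be a sequence of $m$ distinct items (edges), and let $\hat\sigma_0$ be a sequence of $m$ distinct items. Define sequences $\hat\sigma_1,\ldots,\hat\sigma_m$ (each of length $m$) as follows. For $t=1,\ldots,m$, let $t'$ be the position of $e_t$ in $\hat\sigma_{t-1}$, with $t':=m+1$ if $e_t$ does not occur in $\hat\sigma_{t-1}$ (one has $t'\ge t$, since the first $t-1$ entries of $\hat\sigma_{t-1}$ are $e_1,\ldots,e_{t-1}$). If $t'=t$, set $\hat\sigma_t:=\hat\sigma_{t-1}$. If $t<t'\le m$, obtain $\hat\sigma_t$ by moving $e_t$ from position $t'$ to position $t$ and shifting the entries previously at positions $t,\ldots,t'-1$ one slot to the right. If $t'=m+1$, obtain $\hat\sigma_t$ by inserting $e_t$ at position $t$, shifting the rest of the sequence one slot to the right, and truncating to length $m$. When $t'\ne t$ we say that at time $t$ the item $e_t$ jumps over each position $i$ with $t\le i<t'$. For an item $e$ of $\sigma$ let $\mathrm{index}(e)$ be its position in $\sigma$ and $\widehat{\mathrm{index}}_0(e)$ its position in $\hat\sigma_0$ ($m+1$ if absent). For an integer $\tau\ge0$ let $\mathrm{LOW}(\tau)=\{e\in\sigma:|\mathrm{index}(e)-\widehat{\mathrm{index}}_0(e)|\le\tau\}$ and $\mathrm{HIGH}(\tau)=\{e_1,\ldots,e_m\}\setminus\mathrm{LOW}(\tau)$. Then for any integer $\tau\ge0$ and any position $i\in\{1,\ldots,m\}$, there are at most $\tau+2|\mathrm{HIGH}(\tau)|$ jumps over $i$ (over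 all times $t=1,\ldots,m$). -}

module Defs where

open import Data.Nat using (ℕ; zero; suc; _+_; _*_; _≤_; _<_; _≟_; _<?_; _≤?_; ∣_-_∣)
open import Data.List using (List; []; _∷_; length; take; drop; filter; upTo)
open import Data.Product using (_×_)
open import Relation.Nullary using (Dec; yes; no; ¬_)
open import Relation.Nullary.Decidable using (_×-dec_; ¬?)
open import Relation.Binary.Definitions using (DecidableEquality)
open import Relation.Binary.PropositionalEquality using (_≡_)

-- Conventions: all positions and times are 0-based.  Position p (0-based)
-- corresponds to position p+1 of the paper; time t (0-based) to time t+1.
-- "Absent" is position (length of the list), i.e. m, which corresponds to
-- the paper's m+1.

module _ {A : Set} (_≟A_ : DecidableEquality A) where

  pos : A → List A → ℕ
  pos e [] = zero
  pos e (x ∷ xs) with e ≟A x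
  ... | yes _ = zero
  ... | no  _ = suc (pos e xs)

  insertAtℕ : ℕ → A → List A → List A
  insertAtℕ zero    e xs       = e ∷ xs
  insertAtℕ (suc p) e []       = e ∷ []
  insertAtℕ (suc p) e (x ∷ xs) = x ∷ insertAtℕ p e xs

  removeAtℕ : ℕ → List A → List A
  removeAtℕ p       []       = []
  removeAtℕ zero    (x ∷ xs) = xs
  removeAtℕ (suc p) (x ∷ xs) = x ∷ removeAtℕ p xs

  step : (m t : ℕ) → A → List A → List A
  step m t e s with pos e s ≟ t | pos e s <? m
  ... | yes _ | _     = s
  ... | no  _ | yes _ = insertAtℕ t e (removeAtℕ (pos e s) s)
  ... | no  _ | no  _ = take m (insertAtℕ t e s)

  hat : List A → List A → ℕ → List A
  hat σ σ̂₀ zero = σ̂₀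
  hat σ σ̂₀ (suc t) with drop t σ
  ... | []    = hat σ σ̂₀ t
  ... | e ∷ _ = step (length σ) t e (hat σ σ̂₀ t)

  -- target position t' of the jump at (0-based) time t: position of e_t in σ̂_{t}
  -- (paper: position of e_{t+1} in σ̂_t)
  target : List A → List A → ℕ → ℕ
  target σ σ̂₀ t with drop t σ
  ... | []    = length σ
  ... | e ∷ _ = pos e (hat σ σ̂₀ t)

  JumpsOver : List A → List A → ℕ → ℕ → Set
  JumpsOver σ σ̂₀ t i = ¬ (target σ σ̂₀ t ≡ t) × (t ≤ i × i < target σ σ̂₀ t)

  jumpsOver? : (σ σ̂₀ : List A) (i t : ℕ) → Dec (JumpsOver σ σ̂₀ t i)
  jumpsOver? σ σ̂₀ i t =
    ¬? (target σ σ̂₀ t ≟ t) ×-dec ((t ≤? i) ×-dec (i <? target σ σ̂₀ t))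

  numJumps : List A → List A → ℕ → ℕ
  numJumps σ σ̂₀ i = length (filter (jumpsOver? σ σ̂₀ i) (upTo (length σ)))

  High : List A → List A → ℕ → A → Set
  High σ σ̂₀ τ e = τ < ∣ pos e σ - pos e σ̂₀ ∣

  high? : (σ σ̂₀ : List A) (τ : ℕ) (e : A) → Dec (High σ σ̂₀ τ e)
  high? σ σ̂₀ τ e = τ <? ∣ pos e σ - pos e σ̂₀ ∣

  highCount : List A → List A → ℕ → ℕ
  highCount σ σ̂₀ τ = length (filter (high? σ σ̂₀ τ) σ)

{-# OPTIONS --safe #-}
-- By induction on t, σ̂_t consists of e_1, …, e_t followed by the items of σ̂₀ that are not
-- among them, in their σ̂₀ order, truncated to length m.  Call an item late if its position
-- in σ̂₀ exceeds its position in σ by more than τ; late items are high.  If e_s is not late,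
-- it lies among the first s + τ entries of σ̂₀, and so do all non-late items among
-- e_1, …, e_s; hence at most τ + |HIGH(τ)| unplaced items precede e_s, and e_s jumps from a
-- position at most s + τ + |HIGH(τ)|.  Hence every jump of a non-late item over i happens at
-- one of the τ + |HIGH(τ)| times s with i - τ - |HIGH(τ)| < s ≤ i, while late items make at
-- most |HIGH(τ)| jumps in total.
module Submission where

open import Defs
open import Data.Nat using (ℕ; zero; suc; _+_; _*_; _∸_; _⊓_; _≤_; _<_; z≤n; s≤s; z<s; ∣_-_∣)
open import Data.Nat.Properties
open import Data.List using (List; []; _∷_; _++_; [_]; length; take; drop; filter; map; upTo; applyUpTo)
open import Data.List.Properties using (length-++; filter-accept; filter-reject; filter-all; take-all; take-[]; take-take; ++-assoc; length-take; length-map; length-applyUpTo)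
open import Data.List.Membership.Propositional using (_∈_; _∉_)
open import Data.List.Membership.Propositional.Properties using (∈-++⁺ˡ; ∈-++⁺ʳ; ∈-++⁻; ∈-∃++; ∈-applyUpTo⁺; ∈-upTo⁻; ∈-filter⁻; ∈-filter⁺; ∈-map⁺)
open import Data.List.Relation.Binary.Subset.Propositional using (_⊆_)
import Data.List.Relation.Unary.All as All
open import Data.List.Relation.Unary.Any using (here; there)
open import Data.List.Relation.Unary.AllPairs using (_∷_)
open import Data.List.Relation.Unary.Unique.Propositional using (Unique)
import Data.List.Relation.Unary.Unique.Propositional.Properties as Unique
import Data.List.Membership.DecPropositional as DecMembership
open DecMembership _≟_ using () renaming (_∈?_ to _∈ℕ?_)
open import Data.List.Relation.Binary.Sublist.Propositional using (⊆-refl)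
open import Data.List.Relation.Binary.Sublist.Propositional.Properties using (length-mono-≤; filter⁺; take⁺; take-⊆)
open import Data.Product using (_×_; _,_; proj₁; proj₂; ∃₂)
open import Data.Sum using (inj₁; inj₂)
open import Function using (_∘_; id)
open import Level using (0ℓ)
open import Relation.Nullary using (Dec; yes; no; ¬_)
open import Relation.Nullary.Negation using (contradiction)
open import Relation.Unary using (Pred; Decidable)
open import Relation.Unary.Properties using (∁?)
open import Relation.Binary.Definitions using (DecidableEquality)
open import Relation.Binary.PropositionalEquality using (_≡_; _≢_; refl; sym; trans; cong; cong₂; subst; subst₂; module ≡-Reasoning)

module _ {A : Set} where

  length-filter-∁ : {P : Pred A 0ℓ} (P? : Decidable P) (xs : List A) →
                    length (filter P? xs) + length (filter (∁? P?) xs) ≡ length xs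
  length-filter-∁ P? [] = refl
  length-filter-∁ P? (x ∷ xs) with P? x
  ... | yes _ = cong suc (length-filter-∁ P? xs)
  ... | no  _ = trans (+-suc _ _) (cong suc (length-filter-∁ P? xs))

  ∈-++-∷⁻ : ∀ {x y} (us : List A) {vs} → x ∈ us ++ y ∷ vs → x ≢ y → x ∈ us ++ vs
  ∈-++-∷⁻ us x∈ x≢y with ∈-++⁻ us x∈
  ... | inj₁ x∈us         = ∈-++⁺ˡ x∈us
  ... | inj₂ (here x≡y)   = contradiction x≡y x≢y
  ... | inj₂ (there x∈vs) = ∈-++⁺ʳ us x∈vs

  Unique-⊆⇒length-≤ : {xs ys : List A} → Unique xs → xs ⊆ ys → length xs ≤ length ys
  Unique-⊆⇒length-≤ {[]}     _           _  = z≤n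
  Unique-⊆⇒length-≤ {x ∷ xs} (x∉ ∷ uxs) xs⊆ with ∈-∃++ (xs⊆ (here refl))
  ... | us , vs , refl = begin
    suc (length xs)            ≤⟨ s≤s (Unique-⊆⇒length-≤ uxs xs⊆us++vs) ⟩
    suc (length (us ++ vs))    ≡⟨ cong suc (length-++ us) ⟩
    suc (length us + length vs) ≡⟨ sym (+-suc (length us) (length vs)) ⟩
    length us + length (x ∷ vs) ≡⟨ sym (length-++ us) ⟩
    length (us ++ x ∷ vs)      ∎
    where
    open ≤-Reasoning
    xs⊆us++vs : xs ⊆ us ++ vs
    xs⊆us++vs z∈xs = ∈-++-∷⁻ us (xs⊆ (there z∈xs)) λ { refl → All.lookup x∉ z∈xs refl }

  drop-∈ : ∀ t {xs : List A} {x ys} → drop t xs ≡ x ∷ ys → x ∈ xs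
  drop-∈ zero    {x ∷ xs} refl = here refl
  drop-∈ (suc t) {x ∷ xs} eq   = there (drop-∈ t eq)

  length-take-≤ : ∀ n (xs : List A) → n ≤ length xs → length (take n xs) ≡ n
  length-take-≤ n xs n≤ = trans (length-take n xs) (m≤n⇒m⊓n≡m n≤)

  drop-∷⇒< : ∀ t {xs : List A} {x ys} → drop t xs ≡ x ∷ ys → t < length xs
  drop-∷⇒< zero    {x ∷ xs} refl = s≤s z≤n
  drop-∷⇒< (suc t) {x ∷ xs} eq   = s≤s (drop-∷⇒< t eq)

  drop-nonempty : ∀ t (xs : List A) → t < length xs → ∃₂ λ x ys → drop t xs ≡ x ∷ ys
  drop-nonempty zero    (x ∷ xs) _         = x , xs , refl
  drop-nonempty (suc t) (x ∷ xs) (s≤s t<) = drop-nonempty t xs t<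

  take-suc-drop : ∀ t {xs : List A} {x ys} → drop t xs ≡ x ∷ ys → take (suc t) xs ≡ take t xs ++ [ x ]
  take-suc-drop zero    {x ∷ xs} refl = refl
  take-suc-drop (suc t) {x ∷ xs} eq   = cong (x ∷_) (take-suc-drop t eq)

  Unique-drop⇒∉take : ∀ t {xs : List A} {x ys} → Unique xs → drop t xs ≡ x ∷ ys → x ∉ take t xs
  Unique-drop⇒∉take (suc t) {y ∷ xs} (y∉ ∷ _) eq (here refl) = All.lookup y∉ (drop-∈ t eq) refl
  Unique-drop⇒∉take (suc t) {y ∷ xs} (_ ∷ u) eq (there x∈) = Unique-drop⇒∉take t u eq x∈

  take-++ : ∀ (xs : List A) {ys} n → take (length xs + n) (xs ++ ys) ≡ xs ++ take n ys
  take-++ []       n = refl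
  take-++ (x ∷ xs) n = cong (x ∷_) (take-++ xs n)

module _ {A : Set} {P Q R : Pred A 0ℓ} (P? : Decidable P) (Q? : Decidable Q) (R? : Decidable R) where

  filter-filter : (∀ {x} → P x → Q x → R x) → (∀ {x} → R x → P x × Q x) →
                  (xs : List A) → filter Q? (filter P? xs) ≡ filter R? xs
  filter-filter _     _     []       = refl
  filter-filter P⇒Q⇒R R⇒P×Q (x ∷ xs) with P? x | R? x
  ... | yes px | yes rx = trans (filter-accept Q? (proj₂ (R⇒P×Q rx))) (cong (x ∷_) (filter-filter P⇒Q⇒R R⇒P×Q xs))
  ... | yes px | no ¬rx = trans (filter-reject Q? (¬rx ∘ P⇒Q⇒R px)) (filter-filter P⇒Q⇒R R⇒P×Q xs)
  ... | no ¬px | yes rx = contradiction (proj₁ (R⇒P×Q rx)) ¬px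
  ... | no _   | no _   = filter-filter P⇒Q⇒R R⇒P×Q xs

Unique-window⇒length-≤ : ∀ {ts : List ℕ} i c → Unique ts →
                          (∀ {t} → t ∈ ts → t ≤ i × i < t + c) → length ts ≤ c
Unique-window⇒length-≤ {ts} i c uts window = begin
  length ts                    ≤⟨ Unique-⊆⇒length-≤ uts ts⊆ ⟩
  length (applyUpTo (lo +_) c) ≡⟨ length-applyUpTo (lo +_) c ⟩
  c                            ∎
  where
  open ≤-Reasoning
  lo : ℕ
  lo = suc i ∸ c
  ts⊆ : ts ⊆ applyUpTo (lo +_) c
  ts⊆ {t} t∈ts = subst (_∈ applyUpTo (lo +_) c) (m+[n∸m]≡n lo≤t)
                       (∈-applyUpTo⁺ (lo +_) t-lo<c)
    where
    t≤i : t ≤ i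
    t≤i = proj₁ (window t∈ts)
    lo≤t : lo ≤ t
    lo≤t = m≤n+o⇒m∸n≤o (suc i) c (subst (suc i ≤_) (+-comm t c) (proj₂ (window t∈ts)))
    t-lo<c : t ∸ lo < c
    t-lo<c = subst (t ∸ lo <_) (m+n∸m≡n lo c)
                  (∸-monoˡ-< (<-≤-trans (s≤s t≤i) (subst (suc i ≤_) (+-comm c lo) (m≤n+m∸n (suc i) c))) lo≤t)

module _ {A : Set} (_≟A_ : DecidableEquality A) where

  pos-++ : ∀ {x} (xs : List A) {ys} → x ∉ xs → pos _≟A_ x (xs ++ ys) ≡ length xs + pos _≟A_ x ys
  pos-++ []       _  = refl
  pos-++ {x} (y ∷ xs) x∉ with x ≟A y
  ... | yes x≡y = contradiction (here x≡y) x∉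
  ... | no  _   = cong suc (pos-++ xs (x∉ ∘ there))

  pos-take : ∀ x n (xs : List A) → pos _≟A_ x (take n xs) ≡ pos _≟A_ x xs ⊓ n
  pos-take x zero    xs       = sym (⊓-zeroʳ _)
  pos-take x (suc n) []       = refl
  pos-take x (suc n) (y ∷ xs) with x ≟A y
  ... | yes _ = refl
  ... | no  _ = cong suc (pos-take x n xs)

  ∈-take⇒pos< : ∀ {x} n (xs : List A) → x ∈ take n xs → pos _≟A_ x xs < n
  ∈-take⇒pos< {x} (suc n) (y ∷ xs) x∈ with x ≟A y
  ... | yes _ = s≤s z≤n
  ∈-take⇒pos< (suc n) (y ∷ xs) (here x≡y) | no x≢y = contradiction x≡y x≢y
  ∈-take⇒pos< (suc n) (y ∷ xs) (there x∈) | no _   = s≤s (∈-take⇒pos< n xs x∈)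

  pos<⇒∈-take : ∀ {x} n (xs : List A) → pos _≟A_ x xs < n → pos _≟A_ x xs < length xs → x ∈ take n xs
  pos<⇒∈-take {x} (suc n) (y ∷ xs) p<n p<len with x ≟A y
  ... | yes x≡y = here x≡y
  ... | no  _   = there (pos<⇒∈-take n xs (≤-pred p<n) (≤-pred p<len))

  pos-drop : ∀ t {xs : List A} {x ys} → x ∉ take t xs → drop t xs ≡ x ∷ ys → pos _≟A_ x xs ≡ t
  pos-drop zero {x ∷ xs} _ refl with x ≟A x
  ... | yes _   = refl
  ... | no  x≢x = contradiction refl x≢x
  pos-drop (suc t) {y ∷ xs} {x} x∉ eq with x ≟A y
  ... | yes x≡y = contradiction (here x≡y) x∉
  ... | no  _   = cong suc (pos-drop t (x∉ ∘ there) eq)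

  pos-filter : ∀ {P : Pred A 0ℓ} (P? : Decidable P) {x} → P x → (xs : List A) →
               pos _≟A_ x (filter P? xs) ≡ length (filter P? (take (pos _≟A_ x xs) xs))
  pos-filter P? px [] = refl
  pos-filter P? {x} px (y ∷ xs) with x ≟A y
  ... | yes refl rewrite filter-accept P? {xs = xs} px with x ≟A x
  ...   | yes _   = refl
  ...   | no  x≢x = contradiction refl x≢x
  pos-filter P? {x} px (y ∷ xs) | no x≢y with P? y
  ...   | no  _ = pos-filter P? px xs
  ...   | yes _ with x ≟A y
  ...     | yes x≡y = contradiction x≡y x≢y
  ...     | no  _   = cong suc (pos-filter P? px xs)

  removeAt-pos : ∀ {x} {xs : List A} → Unique xs → removeAtℕ _≟A_ (pos _≟A_ x xs) xs ≡ filter (∁? (_≟A x)) xs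
  removeAt-pos {xs = []} _ = refl
  removeAt-pos {x} {y ∷ xs} (y∉ ∷ uxs) with x ≟A y
  ... | yes refl = sym (trans (filter-reject (∁? (_≟A x)) (λ x≢x → x≢x refl))
                              (filter-all (∁? (_≟A x)) (All.map (λ y≢x → y≢x ∘ sym) y∉)))
  ... | no  x≢y  = sym (trans (filter-accept (∁? (_≟A x)) (x≢y ∘ sym))
                              (cong (y ∷_) (sym (removeAt-pos uxs))))

  insertAt-removeAt-pos : ∀ {x} (xs : List A) → pos _≟A_ x xs < length xs →
    insertAtℕ _≟A_ (pos _≟A_ x xs) x (removeAtℕ _≟A_ (pos _≟A_ x xs) xs) ≡ xs
  insertAt-removeAt-pos {x} (y ∷ xs) p< with x ≟A y
  ... | yes x≡y = cong (_∷ xs) x≡y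
  ... | no  _   = cong (y ∷_) (insertAt-removeAt-pos xs (≤-pred p<))

  insertAt-++ : ∀ x (xs : List A) {ys} → insertAtℕ _≟A_ (length xs) x (xs ++ ys) ≡ xs ++ x ∷ ys
  insertAt-++ x []       = refl
  insertAt-++ x (y ∷ xs) = cong (y ∷_) (insertAt-++ x xs)

  removeAt-++ : ∀ (xs : List A) {ys} k → removeAtℕ _≟A_ (length xs + k) (xs ++ ys) ≡ xs ++ removeAtℕ _≟A_ k ys
  removeAt-++ []       k = refl
  removeAt-++ (x ∷ xs) k = cong (x ∷_) (removeAt-++ xs k)

  removeAt-take : ∀ {k n} → k ≤ n → (xs : List A) →
                  removeAtℕ _≟A_ k (take (suc n) xs) ≡ take n (removeAtℕ _≟A_ k xs)
  removeAt-take {zero}  {n}     _         []       = sym (take-[] n)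
  removeAt-take {suc k} {n}     _         []       = sym (take-[] n)
  removeAt-take {zero}          _         (x ∷ xs) = refl
  removeAt-take {suc k} {suc n} (s≤s k≤n) (x ∷ xs) = cong (x ∷_) (removeAt-take k≤n xs)

  take-removeAt : ∀ {n k} → n ≤ k → (xs : List A) → take n (removeAtℕ _≟A_ k xs) ≡ take n xs
  take-removeAt {zero}              _         xs       = refl
  take-removeAt {suc n}             _         []       = refl
  take-removeAt {suc n} {suc k} (s≤s n≤k) (x ∷ xs) = cong (x ∷_) (take-removeAt n≤k xs)

  step-move : ∀ m t e (s : List A) → pos _≟A_ e s < length s → length s ≡ m →
              step _≟A_ m t e s ≡ insertAtℕ _≟A_ t e (removeAtℕ _≟A_ (pos _≟A_ e s) s)
  step-move m t e s p<len len≡m with pos _≟A_ e s ≟ t | pos _≟A_ e s <? m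
  ... | yes p≡t | _     = subst (λ t → s ≡ insertAtℕ _≟A_ t e (removeAtℕ _≟A_ (pos _≟A_ e s) s)) p≡t
                                (sym (insertAt-removeAt-pos s p<len))
  ... | no  _   | yes _ = refl
  ... | no  _   | no p≮m = contradiction (subst (pos _≟A_ e s <_) len≡m p<len) p≮m

  step-insert : ∀ m t e (s : List A) → t < m → m ≤ pos _≟A_ e s →
                step _≟A_ m t e s ≡ take m (insertAtℕ _≟A_ t e s)
  step-insert m t e s t<m m≤p with pos _≟A_ e s ≟ t | pos _≟A_ e s <? m
  ... | yes p≡t | _       = contradiction (subst (m ≤_) p≡t m≤p) (<⇒≱ t<m)
  ... | no  _   | yes p<m = contradiction p<m (≤⇒≯ m≤p)
  ... | no  _   | no  _   = refl

  step-shape : ∀ {m t e} (P F : List A) n → length P ≡ t → t + suc n ≡ m → e ∉ P → suc n ≤ length F →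
               step _≟A_ m t e (P ++ take (suc n) F) ≡ P ++ e ∷ take n (removeAtℕ _≟A_ (pos _≟A_ e F) F)
  step-shape {e = e} P F n refl refl e∉P n<len = by-cases (k ≤? n)
    where
    open ≡-Reasoning
    t m k : ℕ
    t = length P
    m = t + suc n
    k = pos _≟A_ e F
    X s : List A
    X = take (suc n) F
    s = P ++ X
    pos-s : pos _≟A_ e s ≡ t + k ⊓ suc n
    pos-s = trans (pos-++ P e∉P) (cong (t +_) (pos-take e (suc n) F))

    by-cases : Dec (k ≤ n) → step _≟A_ m t e s ≡ P ++ e ∷ take n (removeAtℕ _≟A_ k F)
    by-cases (yes k≤n) = begin
      step _≟A_ m t e s                                    ≡⟨ step-move m t e s pos<len len≡ ⟩
      insertAtℕ _≟A_ t e (removeAtℕ _≟A_ (pos _≟A_ e s) s) ≡⟨ cong (λ p → insertAtℕ _≟A_ t e (removeAtℕ _≟A_ p s)) pos≡ ⟩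
      insertAtℕ _≟A_ t e (removeAtℕ _≟A_ (t + k) s)        ≡⟨ cong (insertAtℕ _≟A_ t e) (removeAt-++ P k) ⟩
      insertAtℕ _≟A_ t e (P ++ removeAtℕ _≟A_ k X)         ≡⟨ insertAt-++ e P ⟩
      P ++ e ∷ removeAtℕ _≟A_ k X                          ≡⟨ cong (λ ys → P ++ e ∷ ys) (removeAt-take k≤n F) ⟩
      P ++ e ∷ take n (removeAtℕ _≟A_ k F)                 ∎
      where
      len≡ : length s ≡ m
      len≡ = trans (length-++ P) (cong (t +_) (trans (length-take (suc n) F) (m≤n⇒m⊓n≡m n<len)))
      pos≡ : pos _≟A_ e s ≡ t + k
      pos≡ = trans pos-s (cong (t +_) (m≤n⇒m⊓n≡m (m≤n⇒m≤1+n k≤n)))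
      pos<len : pos _≟A_ e s < length s
      pos<len = subst₂ _<_ (sym pos≡) (sym len≡) (+-monoʳ-< t (s≤s k≤n))
    by-cases (no k≰n) = begin
      step _≟A_ m t e s                        ≡⟨ step-insert m t e s (m<m+n t z<s) (≤-reflexive (sym pos≡)) ⟩
      take m (insertAtℕ _≟A_ t e s)            ≡⟨ cong (take m) (insertAt-++ e P) ⟩
      take m (P ++ e ∷ X)                      ≡⟨ take-++ P (suc n) ⟩
      P ++ e ∷ take n X                        ≡⟨ cong (λ ys → P ++ e ∷ ys) take-n-X ⟩
      P ++ e ∷ take n F                        ≡⟨ cong (λ ys → P ++ e ∷ ys) (sym (take-removeAt (<⇒≤ (≰⇒> k≰n)) F)) ⟩
      P ++ e ∷ take n (removeAtℕ _≟A_ k F)     ∎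
      where
      pos≡ : pos _≟A_ e s ≡ m
      pos≡ = trans pos-s (cong (t +_) (m≥n⇒m⊓n≡n (≰⇒> k≰n)))
      take-n-X : take n X ≡ take n F
      take-n-X = trans (take-take n (suc n) F) (cong (λ j → take j F) (m≤n⇒m⊓n≡m (n≤1+n n)))

module Evolution {A : Set} (_≟A_ : DecidableEquality A) (σ σ̂₀ : List A)
                 (|σ̂₀|≡|σ| : length σ̂₀ ≡ length σ) (uσ : Unique σ) (uσ̂₀ : Unique σ̂₀) where

  open DecMembership _≟A_ using (_∈?_)

  m : ℕ
  m = length σ

  remaining : ℕ → List A
  remaining t = filter (∁? (_∈? take t σ)) σ̂₀

  length-remaining : ∀ t → m ∸ t ≤ length (remaining t)
  length-remaining t = begin
    m ∸ t                                              ≤⟨ ∸-monoʳ-≤ m |placed|≤t ⟩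
    m ∸ length placed                                  ≡⟨ cong (_∸ length placed) (sym |placed|+|remaining|≡m) ⟩
    length placed + length (remaining t) ∸ length placed ≡⟨ m+n∸m≡n (length placed) _ ⟩
    length (remaining t)                               ∎
    where
    open ≤-Reasoning
    placed : List A
    placed = filter (_∈? take t σ) σ̂₀
    |placed|≤t : length placed ≤ t
    |placed|≤t = ≤-trans (Unique-⊆⇒length-≤ (Unique.filter⁺ (_∈? take t σ) uσ̂₀)
                                            (proj₂ ∘ ∈-filter⁻ (_∈? take t σ) {xs = σ̂₀}))
                         (subst (_≤ t) (sym (length-take t σ)) (m⊓n≤m t m))
    |placed|+|remaining|≡m : length placed + length (remaining t) ≡ m
    |placed|+|remaining|≡m = trans (length-filter-∁ (_∈? take t σ) σ̂₀) |σ̂₀|≡|σ|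

  module _ (t : ℕ) {e rest} (eq : drop t σ ≡ e ∷ rest) where

    e∉take : e ∉ take t σ
    e∉take = Unique-drop⇒∉take t uσ eq

    hat-suc : hat _≟A_ σ σ̂₀ (suc t) ≡ step _≟A_ m t e (hat _≟A_ σ σ̂₀ t)
    hat-suc rewrite eq = refl

    target≡pos : target _≟A_ σ σ̂₀ t ≡ pos _≟A_ e (hat _≟A_ σ σ̂₀ t)
    target≡pos rewrite eq = refl

    remaining-suc : removeAtℕ _≟A_ (pos _≟A_ e (remaining t)) (remaining t) ≡ remaining (suc t)
    remaining-suc = begin
      removeAtℕ _≟A_ (pos _≟A_ e (remaining t)) (remaining t) ≡⟨ removeAt-pos _≟A_ (Unique.filter⁺ _ uσ̂₀) ⟩
      filter (∁? (_≟A e)) (remaining t)                      ≡⟨ filter-filter _ _ _ ∉P∧≢e⇒∉P∷ʳe ∉P∷ʳe⇒∉P∧≢e σ̂₀ ⟩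
      filter (∁? (_∈? take t σ ++ [ e ])) σ̂₀                 ≡⟨ cong (λ P → filter (∁? (_∈? P)) σ̂₀) (sym (take-suc-drop t eq)) ⟩
      remaining (suc t)                                      ∎
      where
      open ≡-Reasoning
      ∉P∧≢e⇒∉P∷ʳe : ∀ {x} → x ∉ take t σ → x ≢ e → x ∉ take t σ ++ [ e ]
      ∉P∧≢e⇒∉P∷ʳe x∉ x≢e x∈ with ∈-++⁻ (take t σ) x∈
      ... | inj₁ x∈P        = x∉ x∈P
      ... | inj₂ (here x≡e) = x≢e x≡e
      ∉P∷ʳe⇒∉P∧≢e : ∀ {x} → x ∉ take t σ ++ [ e ] → x ∉ take t σ × x ≢ e
      ∉P∷ʳe⇒∉P∧≢e x∉ = x∉ ∘ ∈-++⁺ˡ , x∉ ∘ ∈-++⁺ʳ (take t σ) ∘ here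

  hat≡ : ∀ t → t ≤ m → hat _≟A_ σ σ̂₀ t ≡ take t σ ++ take (m ∸ t) (remaining t)
  hat≡ zero _ = sym (trans (cong (take m) remaining-zero) (take-all m σ̂₀ (≤-reflexive |σ̂₀|≡|σ|)))
    where
    remaining-zero : remaining zero ≡ σ̂₀
    remaining-zero = filter-all (∁? (_∈? [])) (All.universal (λ _ ()) σ̂₀)
  hat≡ (suc t) t<m with drop-nonempty t σ t<m
  ... | e , rest , eq = begin
    hat _≟A_ σ σ̂₀ (suc t)                          ≡⟨ hat-suc t eq ⟩
    step _≟A_ m t e (hat _≟A_ σ σ̂₀ t)              ≡⟨ cong (step _≟A_ m t e) ih ⟩
    step _≟A_ m t e (P ++ take (suc n) F)          ≡⟨ step-shape _≟A_ P F n |P|≡t t+1+n≡m (e∉take t eq) 1+n≤|F| ⟩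
    P ++ e ∷ take n (removeAtℕ _≟A_ (pos _≟A_ e F) F) ≡⟨ cong (λ ys → P ++ e ∷ take n ys) (remaining-suc t eq) ⟩
    P ++ e ∷ take n (remaining (suc t))            ≡⟨ sym (++-assoc P [ e ] _) ⟩
    (P ++ [ e ]) ++ take n (remaining (suc t))     ≡⟨ cong (_++ take n (remaining (suc t))) (sym (take-suc-drop t eq)) ⟩
    take (suc t) σ ++ take n (remaining (suc t))   ∎
    where
    open ≡-Reasoning
    n : ℕ
    n = m ∸ suc t
    P F : List A
    P = take t σ
    F = remaining t
    m∸t≡1+n : m ∸ t ≡ suc n
    m∸t≡1+n = +-∸-assoc 1 t<m
    ih : hat _≟A_ σ σ̂₀ t ≡ P ++ take (suc n) F
    ih = trans (hat≡ t (<⇒≤ t<m)) (cong (λ j → P ++ take j F) m∸t≡1+n)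
    |P|≡t : length P ≡ t
    |P|≡t = length-take-≤ t σ (<⇒≤ t<m)
    t+1+n≡m : t + suc n ≡ m
    t+1+n≡m = trans (cong (t +_) (sym m∸t≡1+n)) (m+[n∸m]≡n (<⇒≤ t<m))
    1+n≤|F| : suc n ≤ length F
    1+n≤|F| = subst (_≤ length F) m∸t≡1+n (length-remaining t)

  module _ (τ : ℕ) where

    Late : A → Set
    Late x = pos _≟A_ x σ + τ < pos _≟A_ x σ̂₀

    late? : Decidable Late
    late? x = pos _≟A_ x σ + τ <? pos _≟A_ x σ̂₀

    lateBefore : ℕ → ℕ
    lateBefore s = length (filter late? (take s σ))

    early-∈-take : ∀ {s x} → s + τ ≤ m → x ∈ take s σ → ¬ Late x → x ∈ take (s + τ) σ̂₀
    early-∈-take {s} {x} s+τ≤m x∈ ¬late =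
      pos<⇒∈-take _≟A_ (s + τ) σ̂₀ pos<s+τ (<-≤-trans pos<s+τ (subst (s + τ ≤_) (sym |σ̂₀|≡|σ|) s+τ≤m))
      where
      pos<s+τ : pos _≟A_ x σ̂₀ < s + τ
      pos<s+τ = ≤-<-trans (≮⇒≥ ¬late) (+-monoˡ-< τ (∈-take⇒pos< _≟A_ s σ x∈))

    pos-remaining-≤ : ∀ s {e rest} → drop s σ ≡ e ∷ rest → ¬ Late e → s + τ ≤ m →
                      pos _≟A_ e (remaining s) ≤ τ + lateBefore s
    pos-remaining-≤ s {e} eq ¬late s+τ≤m = +-cancelˡ-≤ s _ _ (begin
      s + pos _≟A_ e (remaining s) ≡⟨ cong (s +_) (pos-filter _≟A_ unplaced? (e∉take s eq) σ̂₀) ⟩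
      s + length (filter unplaced? (take k σ̂₀))
                                   ≤⟨ +-monoʳ-≤ s (length-mono-≤ (filter⁺ unplaced? unplaced? (λ { refl → id }) (take⁺ k≤s+τ))) ⟩
      s + U                        ≡⟨ cong (_+ U) (sym L+N≡s) ⟩
      L + N + U                    ≤⟨ +-monoˡ-≤ U (+-monoʳ-≤ L N≤Pl) ⟩
      L + Pl + U                   ≡⟨ +-assoc L Pl U ⟩
      L + (Pl + U)                 ≡⟨ cong (L +_) Pl+U≡s+τ ⟩
      L + (s + τ)                  ≡⟨ trans (+-comm L (s + τ)) (+-assoc s τ L) ⟩
      s + (τ + L)                  ∎)
      where
      open ≤-Reasoning
      P W : List A
      P = take s σ
      W = take (s + τ) σ̂₀
      unplaced? : Decidable (_∉ P)
      unplaced? = ∁? (_∈? P)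
      U Pl N L : ℕ
      U  = length (filter unplaced? W)
      Pl = length (filter (_∈? P) W)
      N  = length (filter (∁? late?) P)
      L  = lateBefore s
      k : ℕ
      k = pos _≟A_ e σ̂₀
      k≤s+τ : k ≤ s + τ
      k≤s+τ = subst (λ p → k ≤ p + τ) (pos-drop _≟A_ s (e∉take s eq) eq) (≮⇒≥ ¬late)
      Pl+U≡s+τ : Pl + U ≡ s + τ
      Pl+U≡s+τ = trans (length-filter-∁ (_∈? P) W)
                       (length-take-≤ (s + τ) σ̂₀ (subst (s + τ ≤_) (sym |σ̂₀|≡|σ|) s+τ≤m))
      L+N≡s : L + N ≡ s
      L+N≡s = trans (length-filter-∁ late? P) (length-take-≤ s σ (<⇒≤ (drop-∷⇒< s eq)))
      early⊆placed : filter (∁? late?) P ⊆ filter (_∈? P) W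
      early⊆placed {x} x∈ with ∈-filter⁻ (∁? late?) {xs = P} x∈
      ... | x∈P , ¬late-x = ∈-filter⁺ (_∈? P) (early-∈-take s+τ≤m x∈P ¬late-x) x∈P
      N≤Pl : N ≤ Pl
      N≤Pl = Unique-⊆⇒length-≤ (Unique.filter⁺ (∁? late?) (Unique.take⁺ s uσ)) early⊆placed

    target-≤ : ∀ s {e rest} → drop s σ ≡ e ∷ rest → ¬ Late e → target _≟A_ σ σ̂₀ s ≤ s + (τ + lateBefore s)
    target-≤ s {e} eq ¬late = begin
      target _≟A_ σ σ̂₀ s                         ≡⟨ target≡pos s eq ⟩
      pos _≟A_ e (hat _≟A_ σ σ̂₀ s)               ≡⟨ cong (pos _≟A_ e) (hat≡ s s≤m) ⟩
      pos _≟A_ e (P ++ take (m ∸ s) F)           ≡⟨ pos-++ _≟A_ P (e∉take s eq) ⟩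
      length P + pos _≟A_ e (take (m ∸ s) F)     ≡⟨ cong₂ _+_ (length-take-≤ s σ s≤m) (pos-take _≟A_ e (m ∸ s) F) ⟩
      s + pos _≟A_ e F ⊓ (m ∸ s)                 ≤⟨ +-monoʳ-≤ s (by-cases (s + τ ≤? m)) ⟩
      s + (τ + lateBefore s)                     ∎
      where
      open ≤-Reasoning
      P F : List A
      P = take s σ
      F = remaining s
      s≤m : s ≤ m
      s≤m = <⇒≤ (drop-∷⇒< s eq)
      by-cases : Dec (s + τ ≤ m) → pos _≟A_ e F ⊓ (m ∸ s) ≤ τ + lateBefore s
      by-cases (yes s+τ≤m) = ≤-trans (m⊓n≤m _ _) (pos-remaining-≤ s eq ¬late s+τ≤m)
      by-cases (no s+τ≰m)  = ≤-trans (m⊓n≤n _ _) (≤-trans (m≤n+o⇒m∸n≤o m s (<⇒≤ (≰⇒> s+τ≰m))) (m≤m+n τ _))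

    late⇒high : ∀ {x} → Late x → High _≟A_ σ σ̂₀ τ x
    late⇒high {x} late = begin-strict
      τ                         ≡⟨ sym (m+n∸m≡n a τ) ⟩
      a + τ ∸ a                 <⟨ ∸-monoˡ-< late (m≤m+n a τ) ⟩
      b ∸ a                     ≡⟨ sym (m≤n⇒∣m-n∣≡n∸m (≤-trans (m≤m+n a τ) (<⇒≤ late))) ⟩
      ∣ a - b ∣                 ∎
      where
      open ≤-Reasoning
      a b : ℕ
      a = pos _≟A_ x σ
      b = pos _≟A_ x σ̂₀

    lateCount : ℕ
    lateCount = length (filter late? σ)

    lateCount≤highCount : lateCount ≤ highCount _≟A_ σ σ̂₀ τ
    lateCount≤highCount = length-mono-≤ (filter⁺ late? (high? _≟A_ σ σ̂₀ τ) (λ { refl → late⇒high }) (⊆-refl {x = σ}))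

    lateBefore≤lateCount : ∀ s → lateBefore s ≤ lateCount
    lateBefore≤lateCount s = length-mono-≤ (filter⁺ late? late? (λ { refl → id }) (take-⊆ s σ))

    -- e_s is late iff s ∈ lateTimes, because s is the position of e_s in σ.
    lateTimes : List ℕ
    lateTimes = map (λ x → pos _≟A_ x σ) (filter late? σ)

    module _ (i : ℕ) where

      jumpTimes : List ℕ
      jumpTimes = filter (jumpsOver? _≟A_ σ σ̂₀ i) (upTo m)

      lateJumps≤lateCount : length (filter (_∈ℕ? lateTimes) jumpTimes) ≤ lateCount
      lateJumps≤lateCount = begin
        length (filter (_∈ℕ? lateTimes) jumpTimes) ≤⟨ Unique-⊆⇒length-≤ (Unique.filter⁺ _ (Unique.filter⁺ _ (Unique.upTo⁺ m)))
                                                                       (proj₂ ∘ ∈-filter⁻ (_∈ℕ? lateTimes) {xs = jumpTimes}) ⟩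
        length lateTimes                            ≡⟨ length-map _ (filter late? σ) ⟩
        lateCount                                   ∎
        where open ≤-Reasoning

      earlyJumps≤τ+lateCount : length (filter (∁? (_∈ℕ? lateTimes)) jumpTimes) ≤ τ + lateCount
      earlyJumps≤τ+lateCount =
        Unique-window⇒length-≤ i (τ + lateCount) (Unique.filter⁺ _ (Unique.filter⁺ _ (Unique.upTo⁺ m))) window
        where
        window : ∀ {t} → t ∈ filter (∁? (_∈ℕ? lateTimes)) jumpTimes → t ≤ i × i < t + (τ + lateCount)
        window {t} t∈ with ∈-filter⁻ (∁? (_∈ℕ? lateTimes)) {xs = jumpTimes} t∈
        ... | t∈jumpTimes , t∉lateTimes with ∈-filter⁻ (jumpsOver? _≟A_ σ σ̂₀ i) {xs = upTo m} t∈jumpTimes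
        ...   | t∈upTo , (_ , t≤i , i<target) with drop-nonempty t σ (∈-upTo⁻ t∈upTo)
        ...     | e , rest , eq = t≤i , (begin-strict
          i                                 <⟨ i<target ⟩
          target _≟A_ σ σ̂₀ t                ≤⟨ target-≤ t eq ¬late ⟩
          t + (τ + lateBefore t)            ≤⟨ +-monoʳ-≤ t (+-monoʳ-≤ τ (lateBefore≤lateCount t)) ⟩
          t + (τ + lateCount)               ∎)
          where
          open ≤-Reasoning
          ¬late : ¬ Late e
          ¬late late = t∉lateTimes (subst (_∈ lateTimes) (pos-drop _≟A_ t (e∉take t eq) eq)
                                         (∈-map⁺ (λ x → pos _≟A_ x σ) (∈-filter⁺ late? (drop-∈ t eq) late)))

-- The hypothesis i < m is unused: the argument bounds the jumps over any position.
lemma6 : {A : Set} (_≟A_ : DecidableEquality A) (m : ℕ) (σ σ̂₀ : List A) →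
         length σ ≡ m → length σ̂₀ ≡ m → Unique σ → Unique σ̂₀ →
         (τ i : ℕ) → i < m →
         numJumps _≟A_ σ σ̂₀ i ≤ τ + 2 * highCount _≟A_ σ σ̂₀ τ
lemma6 _≟A_ _ σ σ̂₀ refl |σ̂₀|≡|σ| uσ uσ̂₀ τ i _ = begin
  numJumps _≟A_ σ σ̂₀ i                                         ≡⟨ sym (length-filter-∁ (_∈ℕ? lateTimes τ) (jumpTimes τ i)) ⟩
  length (filter (_∈ℕ? lateTimes τ) (jumpTimes τ i)) +
  length (filter (∁? (_∈ℕ? lateTimes τ)) (jumpTimes τ i))      ≤⟨ +-mono-≤ (lateJumps≤lateCount τ i) (earlyJumps≤τ+lateCount τ i) ⟩
  L + (τ + L)                                                  ≡⟨ +-comm L (τ + L) ⟩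
  τ + L + L                                                    ≡⟨ +-assoc τ L L ⟩
  τ + (L + L)                                                  ≡⟨ cong (λ n → τ + (L + n)) (sym (+-identityʳ L)) ⟩
  τ + 2 * L                                                    ≤⟨ +-monoʳ-≤ τ (*-monoʳ-≤ 2 (lateCount≤highCount τ)) ⟩
  τ + 2 * highCount _≟A_ σ σ̂₀ τ                                ∎
  where
  open Evolution _≟A_ σ σ̂₀ |σ̂₀|≡|σ| uσ uσ̂₀
  open ≤-Reasoning
  L : ℕ
  L = lateCount τ
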